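{- Let $T$ be a tree with $n \ge 2$ vertices. Then $$\left\lceil \frac{n}{2}\right\rceil \le \gamma(M(T)) \le n-1.$$
   Context: For a finite simple graph $G$, the middle graph $M(G)$ is the graph with vertex set $V(G)\cup E(G)$ in which two elements $x,y$ are adjacent if and only if either (1) $x,y\in E(G)$ and the edges $x,y$ share a common endpoint in $G$, or (2) $x\in V(G)$, $y\in E(G)$ and $x$ is an endpoint of $y$ (or vice versa). A dominating set of a graph $H$ is a set $S\subseteq V(H)$ such that every vertex of $H$ is in $S$ or adjacent to a vertex of $S$; the domination number $\gamma(H)$ is the minimum cardinality of a dominating set of $H$. -}

module Defs where

open import Data.Nat using (ℕ; zero; suc; _≤_; _∸_; ⌈_/2⌉)
open import Data.Fin using (Fin) renaming (_<_ to _<ᶠ_)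
open import Data.Bool using (Bool; true; false)
open import Data.List using (List; []; _∷_; length)
open import Data.List.Membership.Propositional using (_∈_)
open import Data.List.Relation.Unary.Unique.Propositional using (Unique)
open import Data.List.Relation.Unary.AllPairs using (AllPairs)
open import Data.Product using (Σ; ∃; ∃-syntax; _×_; _,_)
open import Data.Sum using (_⊎_; inj₁; inj₂)
open import Data.Empty using (⊥)
open import Relation.Binary.PropositionalEquality using (_≡_; _≢_)

record SimpleGraph (n : ℕ) : Set where
  field
    adj    : Fin n → Fin n → Bool
    sym    : ∀ u v → adj u v ≡ adj v u
    irrefl : ∀ u → adj u u ≡ false

open SimpleGraph public

Adj : ∀ {n} → SimpleGraph n → Fin n → Fin n → Set
Adj G u v = adj G u v ≡ true

-- An edge {u,v} is represented once, as the ordered pair with u < v.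
Edge : ∀ {n} → SimpleGraph n → Set
Edge {n} G = Σ (Fin n) λ u → Σ (Fin n) λ v → (u <ᶠ v) × Adj G u v

endpoint₁ endpoint₂ : ∀ {n} {G : SimpleGraph n} → Edge G → Fin n
endpoint₁ (u , _ , _) = u
endpoint₂ (_ , v , _) = v

IsEndpoint : ∀ {n} {G : SimpleGraph n} → Fin n → Edge G → Set
IsEndpoint {G = G} x e = (x ≡ endpoint₁ {G = G} e) ⊎ (x ≡ endpoint₂ {G = G} e)

data Walk {n} (G : SimpleGraph n) : Fin n → Fin n → Set where
  here : ∀ {u} → Walk G u u
  step : ∀ {u w v} → Adj G u w → Walk G w v → Walk G u v

Connected : ∀ {n} → SimpleGraph n → Set
Connected G = ∀ u v → Walk G u v

data Chain {n} (G : SimpleGraph n) : List (Fin n) → Set where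
  []  : Chain G []
  [_] : ∀ x → Chain G (x ∷ [])
  _∷_ : ∀ {x y xs} → Adj G x y → Chain G (y ∷ xs) → Chain G (x ∷ y ∷ xs)

-- A cycle: distinct vertices v₀ v₁ … vₖ (k ≥ 2) with vᵢ ~ vᵢ₊₁ and vₖ ~ v₀.
record Cycle {n} (G : SimpleGraph n) : Set where
  field
    v₀ v₁ vₖ : Fin n
    middle   : List (Fin n)
    distinct : Unique (v₀ ∷ v₁ ∷ Data.List._++_ middle (vₖ ∷ []))
    chain    : Chain G (v₀ ∷ v₁ ∷ Data.List._++_ middle (vₖ ∷ []))
    closing  : Adj G vₖ v₀

Acyclic : ∀ {n} → SimpleGraph n → Set
Acyclic G = Cycle G → ⊥

IsTree : ∀ {n} → SimpleGraph n → Set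
IsTree G = Connected G × Acyclic G

record Graph : Set₁ where
  field
    Vtx : Set
    _~_ : Vtx → Vtx → Set

open Graph public

-- A finite set of vertices is represented by a duplicate-free list;
-- its cardinality is the length of the list.
IsDominatingSet : (H : Graph) → List (Vtx H) → Set
IsDominatingSet H S = ∀ x → (x ∈ S) ⊎ (∃[ y ] (y ∈ S × (_~_ H) y x))

γ≤ : Graph → ℕ → Set
γ≤ H k = ∃[ S ] (Unique S × IsDominatingSet H S × length S ≤ k)

≤γ : ℕ → Graph → Set
≤γ k H = ∀ S → Unique S → IsDominatingSet H S → k ≤ length S

MAdj : ∀ {n} (G : SimpleGraph n) → Fin n ⊎ Edge G → Fin n ⊎ Edge G → Set
MAdj G (inj₁ x) (inj₁ y) = ⊥
MAdj G (inj₁ x) (inj₂ e) = IsEndpoint {G = G} x e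
MAdj G (inj₂ e) (inj₁ x) = IsEndpoint {G = G} x e
MAdj G (inj₂ e) (inj₂ f) = (e ≢ f) × ∃[ x ] (IsEndpoint {G = G} x e × IsEndpoint {G = G} x f)

Middle : ∀ {n} → SimpleGraph n → Graph
Middle {n} G = record { Vtx = Fin n ⊎ Edge G ; _~_ = MAdj G }

module Submission where

-- Lower bound (valid for every simple graph G).  A vertex x of G is
-- dominated in M(G) either by itself or by an edge having x as an
-- endpoint, so x is one of the (at most two) "ends" of some member of a
-- dominating set S.  Hence the n vertices of G are covered by the ends of
-- the |S| members of S, i.e. n ≤ 2|S|, which gives ⌈n/2⌉ ≤ |S|.
--
-- Upper bound (valid for every graph without isolated vertices, in
-- particular for a connected graph on n ≥ 2 vertices).  Choose for every
-- vertex x an edge e(x) at x, and let w be a neighbour of the vertex 0.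
-- The set {e(x) | x ≠ w} has at most n - 1 elements and dominates M(G):
-- a vertex x ≠ w lies on e(x), the vertex w lies on e(0) = 0w, and an
-- edge f has an endpoint z ≠ w, so f equals or meets e(z).

open import Defs hiding (sym)
open import Data.Nat using (ℕ; suc; _≤_; _∸_; _+_; _*_; ⌈_/2⌉; z≤n; s≤s)
import Data.Nat.Properties as ℕ
open import Data.Product using (_×_; _,_; proj₁; proj₂; Σ; ∃-syntax)
open import Data.Sum using (_⊎_; inj₁; inj₂)
open import Data.Empty using (⊥-elim)
import Data.Bool.Properties as Bool
open import Axiom.UniquenessOfIdentityProofs using (module Decidable⇒UIP)
open import Data.Fin using (Fin; zero; suc; punchIn; punchOut; combine)
import Data.Fin.Properties as Fin
open import Data.List using (List; []; _∷_; length; map; allFin; deduplicate; lookup)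
import Data.List.Properties as List
open import Data.List.Membership.Propositional using (_∈_)
open import Data.List.Membership.Propositional.Properties
  using (∈-map⁺; ∈-allFin; ∈-deduplicate⁺)
open import Data.List.Relation.Unary.Any using (index)
open import Data.List.Relation.Unary.Any.Properties using (lookup-index)
open import Data.List.Relation.Unary.Unique.Propositional using (Unique)
import Data.List.Relation.Unary.Unique.Propositional.Properties as Unique
open import Data.List.Relation.Unary.Unique.DecPropositional.Properties
  using (deduplicate-!)
open import Relation.Nullary using (¬_; yes; no; ¬?)
open import Relation.Binary using (tri<; tri≈; tri>; DecidableEquality)
open import Relation.Binary.PropositionalEquality
open import Function using (_∘_)

module _ {n : ℕ} (G : SimpleGraph n) where

  ¬adj-self : ∀ {x} → ¬ Adj G x x
  ¬adj-self {x} x~x with () ← trans (sym x~x) (irrefl G x)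

  -- Two edges are equal as soon as their endpoints are: the order and
  -- adjacency proofs inside an edge are proof-irrelevant.
  _≟ᴱ_ : DecidableEquality (Edge G)
  (u , v , u<v , u~v) ≟ᴱ (u′ , v′ , u′<v′ , u′~v′) with u Fin.≟ u′ | v Fin.≟ v′
  ... | no u≢u′  | _        = no λ { refl → u≢u′ refl }
  ... | yes _    | no v≢v′  = no λ { refl → v≢v′ refl }
  ... | yes refl | yes refl =
    yes (cong₂ (λ lt adj → (u , v , lt , adj))
               (Fin.<-irrelevant u<v u′<v′)
               (Decidable⇒UIP.≡-irrelevant Bool._≟_ u~v u′~v′))

  edgeBetween : ∀ {x w} → Adj G x w →
                Σ (Edge G) λ e → IsEndpoint {G = G} x e × IsEndpoint {G = G} w e
  edgeBetween {x} {w} x~w with Fin.<-cmp x w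
  ... | tri< x<w _ _  = (x , w , x<w , x~w) , inj₁ refl , inj₂ refl
  ... | tri≈ _ refl _ = ⊥-elim (¬adj-self x~w)
  ... | tri> _ _ w<x  = (w , x , w<x , trans (SimpleGraph.sym G w x) x~w) , inj₂ refl , inj₁ refl

covered⇒≤ : ∀ {m k n} (f : Fin m → Fin k → Fin n) →
            (∀ x → ∃[ i ] ∃[ b ] f i b ≡ x) → n ≤ m * k
covered⇒≤ {m} {k} f cover = Fin.injective⇒≤ code-injective
  where
  code : Fin _ → Fin (m * k)
  code x = combine (proj₁ (cover x)) (proj₁ (proj₂ (cover x)))

  code-injective : ∀ {x y} → code x ≡ code y → x ≡ y
  code-injective {x} {y} eq
    with i≡j , b≡c ← Fin.combine-injective _ _ _ _ eq = begin
      x                                             ≡⟨ sym (proj₂ (proj₂ (cover x))) ⟩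
      f (proj₁ (cover x)) (proj₁ (proj₂ (cover x))) ≡⟨ cong₂ f i≡j b≡c ⟩
      f (proj₁ (cover y)) (proj₁ (proj₂ (cover y))) ≡⟨ proj₂ (proj₂ (cover y)) ⟩
      y                                             ∎
    where open ≡-Reasoning

⌈/2⌉-≤ : ∀ {n m} → n ≤ m * 2 → ⌈ n /2⌉ ≤ m
⌈/2⌉-≤ {n} {m} n≤2m = begin
  ⌈ n /2⌉       ≤⟨ ℕ.⌈n/2⌉-mono n≤2m ⟩
  ⌈ m * 2 /2⌉   ≡⟨ cong ⌈_/2⌉ (trans (ℕ.*-comm m 2) (cong (m +_) (ℕ.+-identityʳ m))) ⟩
  ⌈ m + m /2⌉   ≡⟨ sym (ℕ.n≡⌈n+n/2⌉ m) ⟩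
  m             ∎
  where open ℕ.≤-Reasoning

module _ {n : ℕ} (G : SimpleGraph n) where

  ends : Fin n ⊎ Edge G → Fin 2 → Fin n
  ends (inj₁ x) _       = x
  ends (inj₂ e) zero    = endpoint₁ {G = G} e
  ends (inj₂ e) (suc _) = endpoint₂ {G = G} e

  dominated⇒end : ∀ {S} → IsDominatingSet (Middle G) S →
                  ∀ x → ∃[ s ] (s ∈ S × ∃[ b ] ends s b ≡ x)
  dominated⇒end D x with D (inj₁ x)
  ... | inj₁ x∈S                        = inj₁ x , x∈S , zero , refl
  ... | inj₂ (inj₂ e , e∈S , inj₁ x≡e₁) = inj₂ e , e∈S , zero , sym x≡e₁
  ... | inj₂ (inj₂ e , e∈S , inj₂ x≡e₂) = inj₂ e , e∈S , suc zero , sym x≡e₂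

  dominating⇒n≤2∣S∣ : ∀ S → IsDominatingSet (Middle G) S → n ≤ length S * 2
  dominating⇒n≤2∣S∣ S D = covered⇒≤ (λ i b → ends (lookup S i) b) cover
    where
    cover : ∀ x → ∃[ i ] ∃[ b ] ends (lookup S i) b ≡ x
    cover x with s , s∈S , b , end≡x ← dominated⇒end D x =
      index s∈S , b , trans (cong (λ t → ends t b) (sym (lookup-index s∈S))) end≡x

  middle-lower-bound : ≤γ ⌈ n /2⌉ (Middle G)
  middle-lower-bound S _ D = ⌈/2⌉-≤ (dominating⇒n≤2∣S∣ S D)

length-deduplicate : ∀ {A : Set} (_≟_ : DecidableEquality A) xs →
                     length (deduplicate _≟_ xs) ≤ length xs
length-deduplicate _≟_ []       = z≤n
length-deduplicate _≟_ (x ∷ xs) =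
  s≤s (ℕ.≤-trans (List.length-filter (¬? ∘ (x ≟_)) (deduplicate _≟_ xs))
                 (length-deduplicate _≟_ xs))

module EdgeDomination {k : ℕ} (G : SimpleGraph (suc k))
                      (neighbour : ∀ x → ∃[ w ] Adj G x w) where

  e : Fin (suc k) → Edge G
  e x = proj₁ (edgeBetween G (proj₂ (neighbour x)))

  x∈e : ∀ x → IsEndpoint {G = G} x (e x)
  x∈e x = proj₁ (proj₂ (edgeBetween G (proj₂ (neighbour x))))

  w : Fin (suc k)
  w = proj₁ (neighbour zero)

  w∈e0 : IsEndpoint {G = G} w (e zero)
  w∈e0 = proj₂ (proj₂ (edgeBetween G (proj₂ (neighbour zero))))

  w≢0 : w ≢ zero
  w≢0 w≡0 = ¬adj-self G (subst (Adj G zero) w≡0 (proj₂ (neighbour zero)))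

  -- The dominating set {e(x) | x ≠ w}: the k vertices ≠ w are enumerated
  -- as punchIn w i, and repeated edges are removed.
  candidates : List (Edge G)
  candidates = map (e ∘ punchIn w) (allFin k)

  edges : List (Edge G)
  edges = deduplicate (_≟ᴱ_ G) candidates

  S : List (Fin (suc k) ⊎ Edge G)
  S = map inj₂ edges

  e∈S : ∀ x → w ≢ x → inj₂ (e x) ∈ S
  e∈S x w≢x = ∈-map⁺ inj₂ (∈-deduplicate⁺ (_≟ᴱ_ G)
    (subst (λ z → e z ∈ candidates) (Fin.punchIn-punchOut w≢x)
           (∈-map⁺ (e ∘ punchIn w) (∈-allFin (punchOut w≢x)))))

  dominate-edge : ∀ f z → w ≢ z → IsEndpoint {G = G} z f →
                  (inj₂ f ∈ S) ⊎ (∃[ y ] (y ∈ S × MAdj G y (inj₂ f)))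
  dominate-edge f z w≢z z∈f with _≟ᴱ_ G (e z) f
  ... | yes refl = inj₁ (e∈S z w≢z)
  ... | no ez≢f  = inj₂ (inj₂ (e z) , e∈S z w≢z , ez≢f , z , x∈e z , z∈f)

  S-dominating : IsDominatingSet (Middle G) S
  S-dominating (inj₁ x) with w Fin.≟ x
  ... | yes refl = inj₂ (inj₂ (e zero) , e∈S zero w≢0 , w∈e0)
  ... | no w≢x   = inj₂ (inj₂ (e x) , e∈S x w≢x , x∈e x)
  S-dominating (inj₂ f@(u , v , u<v , _)) with w Fin.≟ u
  ... | no w≢u   = dominate-edge f u w≢u (inj₁ refl)
  ... | yes refl = dominate-edge f v (Fin.<⇒≢ u<v) (inj₂ refl)

  S-unique : Unique S
  S-unique = Unique.map⁺ (λ { refl → refl }) (deduplicate-! (_≟ᴱ_ G) candidates)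

  S-small : length S ≤ k
  S-small = begin
    length S           ≡⟨ List.length-map inj₂ edges ⟩
    length edges       ≤⟨ length-deduplicate (_≟ᴱ_ G) candidates ⟩
    length candidates  ≡⟨ List.length-map (e ∘ punchIn w) (allFin k) ⟩
    length (allFin k)  ≡⟨ List.length-tabulate {n = k} (λ i → i) ⟩
    k                  ∎
    where open ℕ.≤-Reasoning

  middle-upper-bound : γ≤ (Middle G) k
  middle-upper-bound = S , S-unique , S-dominating , S-small

connected⇒neighbour : ∀ {m} (G : SimpleGraph (suc (suc m))) → Connected G →
                      ∀ x → ∃[ w ] Adj G x w
connected⇒neighbour G connected x = first-step (connected x (other x)) (other≢ x)
  where
  other : Fin _ → Fin _
  other zero    = suc zero
  other (suc _) = zero

  other≢ : ∀ x → x ≢ other x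
  other≢ zero    ()
  other≢ (suc _) ()

  first-step : ∀ {x y} → Walk G x y → x ≢ y → ∃[ w ] Adj G x w
  first-step here         x≢x = ⊥-elim (x≢x refl)
  first-step (step x~w _) _   = _ , x~w

-- The theorem: both bounds hold for T since a tree on n ≥ 2 vertices is
-- connected.
theorem2p3 : (n : ℕ) → 2 ≤ n → (T : SimpleGraph n) → IsTree T →
    ≤γ ⌈ n /2⌉ (Middle T) × γ≤ (Middle T) (n ∸ 1)
theorem2p3 (suc (suc m)) (s≤s (s≤s z≤n)) T (connected , _) =
  middle-lower-bound T ,
  EdgeDomination.middle-upper-bound T (connected⇒neighbour T connected)
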